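{- Let $S$ be a Kleene relation algebra satisfying the Tarski rule, let $x \in S$, and let $y, z \in S$ be points. Then $x^T \cdot y = z$ if and only if $y \sqcap x = y \cdot z^T$.
   Context: A Kleene relation algebra is a structure $(S,\sqcup,\sqcap,\cdot,\overline{\phantom{x}},{}^T,{}^*,\bot,\top,1)$ such that $(S,\sqcup,\sqcap,\overline{\phantom{x}},\bot,\top)$ is a Boolean algebra with order $x \sqsubseteq y \iff x \sqcup y = y$; $(S,\sqcup,\cdot,\bot,1)$ is an idempotent semiring ($\cdot$ associative with two-sided unit $1$, distributing over $\sqcup$ on both sides, $\bot$ a two-sided zero of $\cdot$); transposition satisfies $(x\sqcup y)^T = x^T \sqcup y^T$, $(x^T)^T = x$, $(x\cdot y)^T = y^T\cdot x^T$ and $(x\cdot y)\sqcap z \sqsubseteq x\cdot(y\sqcap(x^T\cdot z))$; and the star satisfies $1\sqcup y\cdot y^* = y^* = 1 \sqcup y^*\cdot y$, $z\sqcup y\cdot x\sqsubseteq x \Rightarrow y^*\cdot z\sqsubseteq x$, and $z \sqcup x\cdot y \sqsubseteq x \Rightarrow z\cdot y^*\sqsubseteq x$. The Tarski rule states $\top\cdot x\cdot\top = \top$ for every $x \neq \bot$. An element $x$ is injective if $x\cdot x^T \sqsubseteq 1$, surjective if $1 \sqsubseteq x^T\cdot x$, bijective if injective and surjective, a vector if $x\cdot\top = x$, and a point if it is a bijective vector. (The expression $x^T\cdot y$ is the paper's "array read" of $x$ at $y$, and $(y \sqcap z^T)\sqcup(\overline{y}\sqcap x)$ its "array write".) -}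

module Defs where

open import Level using (Level; suc; _⊔_)
open import Relation.Binary.PropositionalEquality using (_≡_)
open import Relation.Nullary using (¬_)
open import Data.Product using (_×_)
open import Algebra.Core using (Op₁; Op₂)
import Algebra.Structures as AS
import Algebra.Lattice.Structures as LS

record KleeneRelationAlgebra (c : Level) : Set (suc c) where
  infixr 6 _⊔ₛ_
  infixr 7 _⊓_
  infixr 8 _·_
  field
    S    : Set c
    _⊔ₛ_ : Op₂ S
    _⊓_  : Op₂ S
    _·_  : Op₂ S
    ‾    : Op₁ S
    _ᵀ   : Op₁ S
    _⋆   : Op₁ S
    ⊥ₛ   : S
    ⊤ₛ   : S
    𝟏    : S

  _⊑_ : S → S → Set c
  x ⊑ y = (x ⊔ₛ y) ≡ y

  field
    isBooleanAlgebra      : LS.IsBooleanAlgebra _≡_ _⊔ₛ_ _⊓_ ‾ ⊤ₛ ⊥ₛ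
    isIdempotentSemiring  : AS.IsIdempotentSemiring _≡_ _⊔ₛ_ _·_ ⊥ₛ 𝟏
    ᵀ-⊔         : ∀ x y → ((x ⊔ₛ y) ᵀ) ≡ ((x ᵀ) ⊔ₛ (y ᵀ))
    ᵀ-invol     : ∀ x → ((x ᵀ) ᵀ) ≡ x
    ᵀ-·         : ∀ x y → ((x · y) ᵀ) ≡ ((y ᵀ) · (x ᵀ))
    dedekind    : ∀ x y z → ((x · y) ⊓ z) ⊑ (x · (y ⊓ ((x ᵀ) · z)))
    ⋆-unfoldˡ   : ∀ y → (𝟏 ⊔ₛ (y · (y ⋆))) ≡ (y ⋆)
    ⋆-unfoldʳ   : ∀ y → (𝟏 ⊔ₛ ((y ⋆) · y)) ≡ (y ⋆)
    ⋆-inductˡ   : ∀ x y z → (z ⊔ₛ (y · x)) ⊑ x → ((y ⋆) · z) ⊑ x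
    ⋆-inductʳ   : ∀ x y z → (z ⊔ₛ (x · y)) ⊑ x → (z · (y ⋆)) ⊑ x

  Tarski : Set c
  Tarski = ∀ x → ¬ (x ≡ ⊥ₛ) → ((⊤ₛ · x) · ⊤ₛ) ≡ ⊤ₛ

  injective surjective bijective vector point : S → Set c
  injective x  = (x · (x ᵀ)) ⊑ 𝟏
  surjective x = 𝟏 ⊑ ((x ᵀ) · x)
  bijective x  = injective x × surjective x
  vector x     = (x · ⊤ₛ) ≡ x
  point x      = vector x × bijective x

-- Transposing, the left-hand side says y ᵀ · x = z ᵀ.  As y is an injective vector,
-- the Dedekind rule gives y ⊓ x = y · (y ᵀ · x), so the right-hand side says
-- y · (y ᵀ · x) = y · z ᵀ.  Left multiplication by the bijective y is undone by y ᵀ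
-- on both sides: on y ᵀ · x because y ᵀ · y · y ᵀ = y ᵀ, and on z ᵀ because the
-- vector z makes z ᵀ a row, ⊤ · z ᵀ = z ᵀ.
module Submission where

open import Defs
open import Level using (Level)
open import Data.Product using (_,_)
open import Function.Bundles using (_⇔_; mk⇔)
import Function.Properties.Equivalence as ⇔
open import Relation.Binary.PropositionalEquality
  using (_≡_; refl; sym; trans; cong; cong₂; isEquivalence)
open import Relation.Binary.Bundles using (Poset)
import Algebra.Structures as AS
import Algebra.Lattice.Structures as LS
open import Algebra.Lattice.Bundles using (BooleanAlgebra)
import Algebra.Lattice.Properties.BooleanAlgebra as BooleanAlgebraProperties

module KleeneRelationAlgebraProperties {c : Level} (K : KleeneRelationAlgebra c) where

  open KleeneRelationAlgebra K
  open LS.IsBooleanAlgebra isBooleanAlgebra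
    using (∨-distribˡ-∧)

  booleanAlgebra : BooleanAlgebra c c
  booleanAlgebra = record { isBooleanAlgebra = isBooleanAlgebra }

  open BooleanAlgebraProperties booleanAlgebra using (∨-zeroʳ; ∧-identityˡ)
  open AS.IsIdempotentSemiring isIdempotentSemiring
    using (+-idem; +-comm; +-assoc; *-assoc; *-identityˡ; *-identityʳ; distribˡ; distribʳ)

  ⊑-reflexive : ∀ {a b} → a ≡ b → a ⊑ b
  ⊑-reflexive {a} refl = +-idem a

  ⊑-trans : ∀ {a b d} → a ⊑ b → b ⊑ d → a ⊑ d
  ⊑-trans {a} {b} {d} a⊑b b⊑d = trans (cong (a ⊔ₛ_) (sym b⊑d))
    (trans (sym (+-assoc a b d)) (trans (cong (_⊔ₛ d) a⊑b) b⊑d))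

  ⊑-antisym : ∀ {a b} → a ⊑ b → b ⊑ a → a ≡ b
  ⊑-antisym {a} {b} a⊑b b⊑a = trans (sym b⊑a) (trans (+-comm b a) a⊑b)

  ⊑-poset : Poset c c c
  ⊑-poset = record
    { _≤_            = _⊑_
    ; isPartialOrder = record
      { isPreorder = record
        { isEquivalence = isEquivalence
        ; reflexive     = ⊑-reflexive
        ; trans         = ⊑-trans
        }
      ; antisym    = ⊑-antisym
      }
    }

  open import Relation.Binary.Reasoning.PartialOrder ⊑-poset

  ⊑-⊤ : ∀ a → a ⊑ ⊤ₛ
  ⊑-⊤ = ∨-zeroʳ

  ⊓-glb : ∀ {d a b} → d ⊑ a → d ⊑ b → d ⊑ (a ⊓ b)
  ⊓-glb {d} {a} {b} d⊑a d⊑b = trans (∨-distribˡ-∧ d a b) (cong₂ _⊓_ d⊑a d⊑b)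

  ·-monoˡ : ∀ d {a b} → a ⊑ b → (d · a) ⊑ (d · b)
  ·-monoˡ d {a} {b} a⊑b = trans (sym (distribˡ d a b)) (cong (d ·_) a⊑b)

  ·-monoʳ : ∀ d {a b} → a ⊑ b → (a · d) ⊑ (b · d)
  ·-monoʳ d {a} {b} a⊑b = trans (sym (distribʳ d a b)) (cong (_· d) a⊑b)

  ᵀ-mono : ∀ {a b} → a ⊑ b → (a ᵀ) ⊑ (b ᵀ)
  ᵀ-mono {a} {b} a⊑b = trans (sym (ᵀ-⊔ a b)) (cong _ᵀ a⊑b)

  ᵀ-injective : ∀ {a b} → (a ᵀ) ≡ (b ᵀ) → a ≡ b
  ᵀ-injective {a} {b} aᵀ≡bᵀ = trans (sym (ᵀ-invol a)) (trans (cong _ᵀ aᵀ≡bᵀ) (ᵀ-invol b))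

  ᵀ-ᵀ· : ∀ a b → (((a ᵀ) · b) ᵀ) ≡ ((b ᵀ) · a)
  ᵀ-ᵀ· a b = trans (ᵀ-· (a ᵀ) b) (cong ((b ᵀ) ·_) (ᵀ-invol a))

  ᵀ·≡⇔ᵀ·≡ᵀ : ∀ a b d → (((a ᵀ) · b) ≡ d) ⇔ (((b ᵀ) · a) ≡ (d ᵀ))
  ᵀ·≡⇔ᵀ·≡ᵀ a b d = mk⇔
    (λ aᵀb≡d → trans (sym (ᵀ-ᵀ· a b)) (cong _ᵀ aᵀb≡d))
    (λ bᵀa≡dᵀ → ᵀ-injective (trans (ᵀ-ᵀ· a b) bᵀa≡dᵀ))

  ⊤ᵀ≡⊤ : (⊤ₛ ᵀ) ≡ ⊤ₛ
  ⊤ᵀ≡⊤ = ⊑-antisym (⊑-⊤ (⊤ₛ ᵀ)) (begin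
    ⊤ₛ           ≡⟨ ᵀ-invol ⊤ₛ ⟨
    ((⊤ₛ ᵀ) ᵀ)   ≤⟨ ᵀ-mono (⊑-⊤ (⊤ₛ ᵀ)) ⟩
    (⊤ₛ ᵀ)       ∎)

  vector⇒⊤·ᵀ≡ᵀ : ∀ {z} → vector z → (⊤ₛ · (z ᵀ)) ≡ (z ᵀ)
  vector⇒⊤·ᵀ≡ᵀ {z} z⊤≡z = begin-equality
    ⊤ₛ · (z ᵀ)        ≡⟨ cong (_· (z ᵀ)) ⊤ᵀ≡⊤ ⟨
    (⊤ₛ ᵀ) · (z ᵀ)    ≡⟨ ᵀ-· z ⊤ₛ ⟨
    ((z · ⊤ₛ) ᵀ)      ≡⟨ cong _ᵀ z⊤≡z ⟩
    (z ᵀ)             ∎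

  injective-vector⇒⊓≡·ᵀ· : ∀ {y} x → vector y → injective y →
                           (y ⊓ x) ≡ (y · ((y ᵀ) · x))
  injective-vector⇒⊓≡·ᵀ· {y} x y⊤≡y yyᵀ⊑1 = ⊑-antisym
    (begin
      y ⊓ x                         ≡⟨ cong (_⊓ x) y⊤≡y ⟨
      (y · ⊤ₛ) ⊓ x                  ≤⟨ dedekind y ⊤ₛ x ⟩
      y · (⊤ₛ ⊓ ((y ᵀ) · x))        ≡⟨ cong (y ·_) (∧-identityˡ _) ⟩
      y · ((y ᵀ) · x)               ∎)
    (⊓-glb
      (begin
        y · ((y ᵀ) · x)             ≤⟨ ·-monoˡ y (⊑-⊤ _) ⟩
        y · ⊤ₛ                      ≡⟨ y⊤≡y ⟩
        y                           ∎)
      (begin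
        y · ((y ᵀ) · x)             ≡⟨ *-assoc y (y ᵀ) x ⟨
        (y · (y ᵀ)) · x             ≤⟨ ·-monoʳ x yyᵀ⊑1 ⟩
        𝟏 · x                       ≡⟨ *-identityˡ x ⟩
        x                           ∎))

  bijective⇒ᵀ··ᵀ≡ᵀ : ∀ {y} → bijective y → (((y ᵀ) · y) · (y ᵀ)) ≡ (y ᵀ)
  bijective⇒ᵀ··ᵀ≡ᵀ {y} (yyᵀ⊑1 , 1⊑yᵀy) = ⊑-antisym
    (begin
      ((y ᵀ) · y) · (y ᵀ)           ≡⟨ *-assoc (y ᵀ) y (y ᵀ) ⟩
      (y ᵀ) · (y · (y ᵀ))           ≤⟨ ·-monoˡ (y ᵀ) yyᵀ⊑1 ⟩
      (y ᵀ) · 𝟏                     ≡⟨ *-identityʳ (y ᵀ) ⟩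
      (y ᵀ)                         ∎)
    (begin
      (y ᵀ)                         ≡⟨ *-identityˡ (y ᵀ) ⟨
      𝟏 · (y ᵀ)                     ≤⟨ ·-monoʳ (y ᵀ) 1⊑yᵀy ⟩
      ((y ᵀ) · y) · (y ᵀ)           ∎)

  surjective⇒ᵀ··≡ : ∀ {y b} → surjective y → (⊤ₛ · b) ≡ b →
                     ((y ᵀ) · (y · b)) ≡ b
  surjective⇒ᵀ··≡ {y} {b} 1⊑yᵀy ⊤b≡b = ⊑-antisym
    (begin
      (y ᵀ) · (y · b)               ≡⟨ *-assoc (y ᵀ) y b ⟨
      ((y ᵀ) · y) · b               ≤⟨ ·-monoʳ b (⊑-⊤ _) ⟩
      ⊤ₛ · b                        ≡⟨ ⊤b≡b ⟩
      b                             ∎)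
    (begin
      b                             ≡⟨ *-identityˡ b ⟨
      𝟏 · b                         ≤⟨ ·-monoʳ b 1⊑yᵀy ⟩
      ((y ᵀ) · y) · b               ≡⟨ *-assoc (y ᵀ) y b ⟩
      (y ᵀ) · (y · b)               ∎)

  bijective-·ᵀ·-cancelˡ : ∀ {y a b} → bijective y → (⊤ₛ · b) ≡ b →
                          (y · ((y ᵀ) · a)) ≡ (y · b) → ((y ᵀ) · a) ≡ b
  bijective-·ᵀ·-cancelˡ {y} {a} {b} y-bij@(_ , 1⊑yᵀy) ⊤b≡b e = begin-equality
    (y ᵀ) · a                       ≡⟨ cong (_· a) (bijective⇒ᵀ··ᵀ≡ᵀ y-bij) ⟨
    (((y ᵀ) · y) · (y ᵀ)) · a       ≡⟨ *-assoc ((y ᵀ) · y) (y ᵀ) a ⟩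
    ((y ᵀ) · y) · ((y ᵀ) · a)       ≡⟨ *-assoc (y ᵀ) y ((y ᵀ) · a) ⟩
    (y ᵀ) · (y · ((y ᵀ) · a))       ≡⟨ cong ((y ᵀ) ·_) e ⟩
    (y ᵀ) · (y · b)                 ≡⟨ surjective⇒ᵀ··≡ 1⊑yᵀy ⊤b≡b ⟩
    b                               ∎

  point⇒ᵀ·≡⇔⊓≡· : ∀ {y b} x → point y → (⊤ₛ · b) ≡ b →
                   (((y ᵀ) · x) ≡ b) ⇔ ((y ⊓ x) ≡ (y · b))
  point⇒ᵀ·≡⇔⊓≡· {y} x (y⊤≡y , y-bij@(yyᵀ⊑1 , _)) ⊤b≡b = mk⇔
    (λ yᵀx≡b → trans y⊓x≡y·yᵀx (cong (y ·_) yᵀx≡b))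
    (λ y⊓x≡yb → bijective-·ᵀ·-cancelˡ y-bij ⊤b≡b (trans (sym y⊓x≡y·yᵀx) y⊓x≡yb))
    where
    y⊓x≡y·yᵀx : (y ⊓ x) ≡ (y · ((y ᵀ) · x))
    y⊓x≡y·yᵀx = injective-vector⇒⊓≡·ᵀ· x y⊤≡y yyᵀ⊑1

theorem1p8 : {c : Level} (K : KleeneRelationAlgebra c) →
    let open KleeneRelationAlgebra K in
    Tarski → (x y z : S) → point y → point z →
    ((((x ᵀ) · y) ≡ z) ⇔ ((y ⊓ x) ≡ (y · (z ᵀ))))
theorem1p8 K _ x y z y-point (z⊤≡z , _) =
  ⇔.trans (ᵀ·≡⇔ᵀ·≡ᵀ x y z) (point⇒ᵀ·≡⇔⊓≡· x y-point (vector⇒⊤·ᵀ≡ᵀ z⊤≡z))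
  where open KleeneRelationAlgebraProperties K
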